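{- Let $G=(V,E)$ be a connected graph with $n=|V|$ vertices and let $1\le \beta\le n$. Let $\mathcal{C}=\{C_1,\dots,C_\alpha\}$ be a maximal family of pairwise vertex-disjoint $\beta$-segments of $G$ (maximal meaning that there is no $\beta$-segment of $G$ disjoint from all of $C_1,\dots,C_\alpha$). Then for every vertex $v \notin \bigcup_{i=1}^{\alpha} C_i$ we have $d_G(v,\mathcal{C}) \le \beta-1$.
   Context: Graphs are simple, undirected, unweighted; $d_G(u,v)$ is the shortest-path distance in $G$. A $\beta$-segment is a set $C\subseteq V$ with $|C|=\beta$ such that the induced subgraph $G[C]$ is connected. For a vertex $v$ and a family $\mathcal{C}$ of vertex sets, $d_G(v,\mathcal{C})$ is the minimum of $d_G(v,u)$ over all $u\in\bigcup_{C\in\mathcal{C}} C$. -}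

module Defs where

open import Data.Nat using (ℕ; zero; suc; _≤_)
open import Data.Fin using (Fin)
open import Data.Fin.Subset using (Subset; _∈_; _∉_; ∣_∣)
open import Data.List using (List)
open import Data.List.Relation.Unary.All using (All)
open import Data.List.Relation.Unary.Any using (Any)
open import Data.List.Relation.Unary.AllPairs using (AllPairs)
open import Data.Product using (Σ; ∃; _×_)
open import Data.Unit using (⊤)
open import Relation.Nullary using (¬_; Dec)

record Graph (n : ℕ) : Set₁ where
  field
    Adj     : Fin n → Fin n → Set
    adj-dec : ∀ u v → Dec (Adj u v)
    sym     : ∀ {u v} → Adj u v → Adj v u
    irrefl  : ∀ {u} → ¬ Adj u u
open Graph public

data WalkIn {n : ℕ} (G : Graph n) (P : Fin n → Set) : Fin n → Fin n → ℕ → Set where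
  here : ∀ {u} → P u → WalkIn G P u u 0
  step : ∀ {u w v k} → P u → Adj G u w → WalkIn G P w v k → WalkIn G P u v (suc k)

Walk : ∀ {n} → Graph n → Fin n → Fin n → ℕ → Set
Walk G = WalkIn G (λ _ → ⊤)

Connected : ∀ {n} → Graph n → Set
Connected G = ∀ u v → ∃ λ k → Walk G u v k

IsDist : ∀ {n} → Graph n → Fin n → Fin n → ℕ → Set
IsDist G u v d = Walk G u v d × (∀ k → Walk G u v k → d ≤ k)

Segment : ∀ {n} → Graph n → ℕ → Subset n → Set
Segment G β C =
  (∣ C ∣ ≡ β) × (∀ u v → u ∈ C → v ∈ C → ∃ λ k → WalkIn G (_∈ C) u v k)
  where open import Relation.Binary.PropositionalEquality using (_≡_)

DisjointSets : ∀ {n} → Subset n → Subset n → Set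
DisjointSets {n} C D = ∀ (x : Fin n) → x ∈ C → x ∉ D

_∈⋃_ : ∀ {n} → Fin n → List (Subset n) → Set
v ∈⋃ 𝒞 = Any (v ∈_) 𝒞

MaximalDisjointSegments : ∀ {n} → Graph n → ℕ → List (Subset n) → Set
MaximalDisjointSegments G β 𝒞 =
  All (Segment G β) 𝒞 ×
  AllPairs DisjointSets 𝒞 ×
  (∀ D → Segment G β D → ¬ All (DisjointSets D) 𝒞)

IsSetDist : ∀ {n} → Graph n → Fin n → List (Subset n) → ℕ → Set
IsSetDist G v 𝒞 d =
  (∃ λ u → u ∈⋃ 𝒞 × IsDist G v u d) ×
  (∀ u d' → u ∈⋃ 𝒞 → IsDist G v u d' → d ≤ d')

{-# OPTIONS --safe #-}
-- Grow a connected set S around v one vertex at a time, always across an edge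
-- leaving S, as long as that edge does not enter ⋃ 𝒞. Every vertex of S is reached
-- from v inside S by a walk shorter than ∣ S ∣. If S ever reached β vertices it
-- would be a β-segment disjoint from 𝒞, contradicting maximality; so before that
-- an edge from S into ⋃ 𝒞 appears, at distance at most ∣ S ∣ ≤ β - 1 from v.
module Submission where

open import Defs
open import Data.Nat using (ℕ; zero; suc; _≤_; _<_; _∸_; s≤s; z≤n; s≤s⁻¹)
open import Data.Nat.Properties using (≮⇒≥; <⇒≱; ≤-trans; m≤n⇒m≤1+n; n≤1+n; anyUpTo?)
open import Data.Nat.Induction using (<-rec)
open import Data.Fin using (Fin; _≟_)
open import Data.Fin.Properties using (any?)
open import Data.Fin.Subset using (Subset; _∈_; _∉_; _⊆_; _∪_; ⁅_⁆; ⊤; ∣_∣; inside; outside)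
open import Data.Fin.Subset.Properties
  using (_∈?_; x∈⁅x⁆; x∈⁅y⁆⇒x≡y; ∣⁅x⁆∣≡1; x∈p∪q⁺; x∈p∪q⁻; ∪-identityˡ; p⊆q⇒∣p∣≤∣q∣; ∣⊤∣≡n)
open import Data.Vec.Base using (_∷_; here; there)
open import Data.List using (List)
import Data.List.Relation.Unary.All as All
import Data.List.Relation.Unary.Any as Any
open import Data.Product using (∃; _×_; _,_; proj₁; proj₂)
open import Data.Sum using (_⊎_; inj₁; inj₂)
open import Data.Unit using (tt)
open import Function using (_∘_)
open import Relation.Nullary using (¬_; Dec; yes; no; ¬?; contradiction)
open import Relation.Nullary.Decidable using (_×-dec_; decidable-stable)
open import Relation.Unary using (Pred; Decidable)
open import Relation.Binary.PropositionalEquality using (_≡_; refl; cong; subst)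
import Relation.Binary.PropositionalEquality as ≡

private
  variable
    n : ℕ

IsMinimum : ∀ {p} → Pred ℕ p → Pred ℕ p
IsMinimum P k = P k × (∀ {j} → P j → k ≤ j)

least : ∀ {p} {P : Pred ℕ p} → Decidable P → ∀ {m} → P m → ∃ (IsMinimum P)
least {P = P} P? {m} = <-rec (λ m → P m → ∃ (IsMinimum P)) search m
  where
  search : ∀ m → (∀ {j} → j < m → P j → ∃ (IsMinimum P)) → P m → ∃ (IsMinimum P)
  search m rec Pm with anyUpTo? P? m
  ... | yes (j , j<m , Pj) = rec j<m Pj
  ... | no none = m , Pm , λ {j} Pj → ≮⇒≥ (λ j<m → none (j , j<m , Pj))

∃-∉ : (p : Subset n) → ∣ p ∣ < n → ∃ λ x → x ∉ p
∃-∉ {n} p ∣p∣<n with any? (λ x → ¬? (x ∈? p))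
... | yes found = found
... | no none = contradiction (subst (_≤ ∣ p ∣) (∣⊤∣≡n n) (p⊆q⇒∣p∣≤∣q∣ ⊤⊆p)) (<⇒≱ ∣p∣<n)
  where
  ⊤⊆p : ⊤ ⊆ p
  ⊤⊆p {x} _ = decidable-stable (x ∈? p) (λ x∉p → none (x , x∉p))

∣⁅x⁆∪p∣≡1+∣p∣ : (x : Fin n) (p : Subset n) → x ∉ p → ∣ ⁅ x ⁆ ∪ p ∣ ≡ suc ∣ p ∣
∣⁅x⁆∪p∣≡1+∣p∣ Fin.zero    (outside ∷ p) _   = cong (suc ∘ ∣_∣) (∪-identityˡ p)
∣⁅x⁆∪p∣≡1+∣p∣ Fin.zero    (inside  ∷ p) x∉p = contradiction here x∉p
∣⁅x⁆∪p∣≡1+∣p∣ (Fin.suc x) (outside ∷ p) x∉p = ∣⁅x⁆∪p∣≡1+∣p∣ x p (x∉p ∘ there)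
∣⁅x⁆∪p∣≡1+∣p∣ (Fin.suc x) (inside  ∷ p) x∉p = cong suc (∣⁅x⁆∪p∣≡1+∣p∣ x p (x∉p ∘ there))

module Walks {n : ℕ} (G : Graph n) where

  private
    variable
      P Q : Pred (Fin n) _
      a b c : Fin n
      k j : ℕ

  _++ʷ_ : WalkIn G P a b k → WalkIn G P b c j → ∃ λ l → WalkIn G P a c l
  here _       ++ʷ q = _ , q
  step p e w   ++ʷ q with w ++ʷ q
  ... | _ , wq = _ , step p e wq

  snocʷ : WalkIn G P a b k → Adj G b c → P c → WalkIn G P a c (suc k)
  snocʷ (here p)     e pc = step p e (here pc)
  snocʷ (step p e w) f pc = step p e (snocʷ w f pc)

  reverseʷ : WalkIn G P a b k → WalkIn G P b a k
  reverseʷ (here p)     = here p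
  reverseʷ (step p e w) = snocʷ (reverseʷ w) (Graph.sym G e) p

  mapʷ : (∀ {x} → P x → Q x) → WalkIn G P a b k → WalkIn G Q a b k
  mapʷ f (here p)     = here (f p)
  mapʷ f (step p e w) = step (f p) e (mapʷ f w)

  forgetʷ : WalkIn G P a b k → Walk G a b k
  forgetʷ = mapʷ (λ _ → tt)

  leaving-edge : (S : Subset n) → WalkIn G P a b k → a ∈ S → b ∉ S →
                 ∃ λ u → ∃ λ w → u ∈ S × w ∉ S × Adj G u w
  leaving-edge S (here _) a∈S b∉S = contradiction a∈S b∉S
  leaving-edge {a = a} S (step {w = w} _ e rest) a∈S b∉S with w ∈? S
  ... | yes w∈S = leaving-edge S rest w∈S b∉S
  ... | no  w∉S = a , w , a∈S , w∉S , e

  walk? : ∀ k a b → Dec (Walk G a b k)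
  walk? zero a b with a ≟ b
  ... | yes refl = yes (here tt)
  ... | no  a≢b  = no λ { (here _) → a≢b refl }
  walk? (suc k) a b with any? (λ w → adj-dec G a w ×-dec walk? k w b)
  ... | yes (w , e , rest) = yes (step tt e rest)
  ... | no  none           = no λ { (step _ e rest) → none (_ , e , rest) }

module _ {n : ℕ} (G : Graph n) where

  open Walks G

  Reaches : Fin n → List (Subset n) → ℕ → Set
  Reaches v 𝒞 k = ∃ λ u → u ∈⋃ 𝒞 × Walk G v u k

  reaches? : ∀ v 𝒞 → Decidable (Reaches v 𝒞)
  reaches? v 𝒞 k = any? (λ u → Any.any? (u ∈?_) 𝒞 ×-dec walk? k v u)

  setDist-≤ : ∀ {v k} (𝒞 : List (Subset n)) → Reaches v 𝒞 k → ∃ λ d → IsSetDist G v 𝒞 d × d ≤ k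
  setDist-≤ {v} 𝒞 reaches with least (reaches? v 𝒞) reaches
  ... | d , (u , u∈⋃𝒞 , shortest) , minimal =
    d , ((u , u∈⋃𝒞 , shortest , λ j walk → minimal (u , u∈⋃𝒞 , walk)) ,
         (λ u′ d′ u′∈⋃𝒞 dist → minimal (u′ , u′∈⋃𝒞 , proj₁ dist))) ,
        minimal reaches

  record Rooted (v : Fin n) (S : Subset n) : Set where
    field
      root∈ : v ∈ S
      reach : ∀ {u} → u ∈ S → ∃ λ k → k < ∣ S ∣ × WalkIn G (_∈ S) v u k

  open Rooted

  rooted-⁅⁆ : (v : Fin n) → Rooted v ⁅ v ⁆
  rooted-⁅⁆ v .root∈ = x∈⁅x⁆ v
  rooted-⁅⁆ v .reach u∈⁅v⁆ with x∈⁅y⁆⇒x≡y v u∈⁅v⁆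
  ... | refl = 0 , subst (0 <_) (≡.sym (∣⁅x⁆∣≡1 v)) (s≤s z≤n) , here (x∈⁅x⁆ v)

  rooted-∪ : ∀ {v S u w} → Rooted v S → u ∈ S → w ∉ S → Adj G u w → Rooted v (⁅ w ⁆ ∪ S)
  rooted-∪ {v} {S} {u} {w} rooted u∈S w∉S e = record { root∈ = into (root∈ rooted) ; reach = reach′ }
    where
    into : ∀ {x} → x ∈ S → x ∈ ⁅ w ⁆ ∪ S
    into = x∈p∪q⁺ ∘ inj₂

    size : ∣ ⁅ w ⁆ ∪ S ∣ ≡ suc ∣ S ∣
    size = ∣⁅x⁆∪p∣≡1+∣p∣ w S w∉S

    reach′ : ∀ {x} → x ∈ ⁅ w ⁆ ∪ S → ∃ λ k → k < ∣ ⁅ w ⁆ ∪ S ∣ × WalkIn G (_∈ ⁅ w ⁆ ∪ S) v x k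
    reach′ x∈ with x∈p∪q⁻ ⁅ w ⁆ S x∈
    ... | inj₂ x∈S with reach rooted x∈S
    ...   | k , k<∣S∣ , walk = k , subst (k <_) (≡.sym size) (m≤n⇒m≤1+n k<∣S∣) , mapʷ into walk
    reach′ x∈ | inj₁ x∈⁅w⁆ with x∈⁅y⁆⇒x≡y w x∈⁅w⁆ | reach rooted u∈S
    ... | refl | k , k<∣S∣ , walk =
      suc k , subst (suc k <_) (≡.sym size) (s≤s k<∣S∣) , snocʷ (mapʷ into walk) e x∈

  rooted-connected : ∀ {v S} → Rooted v S → ∀ a b → a ∈ S → b ∈ S → ∃ λ k → WalkIn G (_∈ S) a b k
  rooted-connected rooted a b a∈S b∈S =
    reverseʷ (proj₂ (proj₂ (reach rooted a∈S))) ++ʷ proj₂ (proj₂ (reach rooted b∈S))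

Avoids : Subset n → List (Subset n) → Set
Avoids S 𝒞 = ∀ {x} → x ∈ S → ¬ x ∈⋃ 𝒞

avoids-⁅⁆ : ∀ {x : Fin n} {𝒞} → ¬ x ∈⋃ 𝒞 → Avoids ⁅ x ⁆ 𝒞
avoids-⁅⁆ {x = x} x∉⋃𝒞 y∈⁅x⁆ with x∈⁅y⁆⇒x≡y x y∈⁅x⁆
... | refl = x∉⋃𝒞

avoids-∪ : ∀ {p q : Subset n} {𝒞} → Avoids p 𝒞 → Avoids q 𝒞 → Avoids (p ∪ q) 𝒞
avoids-∪ {p = p} {q} avoids-p avoids-q x∈p∪q with x∈p∪q⁻ p q x∈p∪q
... | inj₁ x∈p = avoids-p x∈p
... | inj₂ x∈q = avoids-q x∈q

avoids⇒disjoint : ∀ {S : Subset n} {𝒞} → Avoids S 𝒞 → All.All (DisjointSets S) 𝒞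
avoids⇒disjoint avoids = All.tabulate λ C∈𝒞 x x∈S x∈C → avoids x∈S (Any.map (λ { refl → x∈C }) C∈𝒞)

module Growth {n : ℕ} (G : Graph n) (connected : Connected G) (𝒞 : List (Subset n))
              (v : Fin n) (v∉⋃𝒞 : ¬ v ∈⋃ 𝒞) where

  open Walks G

  Cluster : ℕ → Set
  Cluster s = ∃ λ S → ∣ S ∣ ≡ s × Rooted G v S × Avoids S 𝒞

  grow : ∀ s → suc s ≤ n → (∃ λ k → k < suc s × Reaches G v 𝒞 k) ⊎ Cluster (suc s)
  grow zero    _ = inj₂ (⁅ v ⁆ , ∣⁅x⁆∣≡1 v , rooted-⁅⁆ G v , avoids-⁅⁆ v∉⋃𝒞)
  grow (suc s) 2+s≤n with grow s (≤-trans (n≤1+n (suc s)) 2+s≤n)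
  ... | inj₁ (k , k<1+s , reaches) = inj₁ (k , m≤n⇒m≤1+n k<1+s , reaches)
  ... | inj₂ (S , ∣S∣≡1+s , rooted , avoids)
    with ∃-∉ S (subst (_< n) (≡.sym ∣S∣≡1+s) 2+s≤n)
  ... | x , x∉S with leaving-edge S (proj₂ (connected v x)) (Rooted.root∈ rooted) x∉S
  ... | u , w , u∈S , w∉S , e with Any.any? (w ∈?_) 𝒞 | Rooted.reach rooted u∈S
  ...   | yes w∈⋃𝒞 | k , k<∣S∣ , walk =
    inj₁ (suc k , s≤s (subst (k <_) ∣S∣≡1+s k<∣S∣) , w , w∈⋃𝒞 , snocʷ (forgetʷ walk) e tt)
  ...   | no  w∉⋃𝒞 | _ =
    inj₂ (⁅ w ⁆ ∪ S , ≡.trans (∣⁅x⁆∪p∣≡1+∣p∣ w S w∉S) (cong suc ∣S∣≡1+s) ,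
          rooted-∪ G rooted u∈S w∉S e , avoids-∪ (avoids-⁅⁆ w∉⋃𝒞) avoids)

proposition1 : ∀ (n : ℕ) (G : Graph n) → Connected G →
    ∀ (β : ℕ) → 1 ≤ β → β ≤ n →
    ∀ (𝒞 : List (Subset n)) → MaximalDisjointSegments G β 𝒞 →
    ∀ v → ¬ (v ∈⋃ 𝒞) →
    ∃ λ d → IsSetDist G v 𝒞 d × d ≤ β ∸ 1
proposition1 n G connected (suc b) (s≤s z≤n) β≤n 𝒞 (_ , _ , maximal) v v∉⋃𝒞
  with Growth.grow G connected 𝒞 v v∉⋃𝒞 b β≤n
... | inj₁ (k , k<β , reaches) =
  let d , dist , d≤k = setDist-≤ G 𝒞 reaches in d , dist , ≤-trans d≤k (s≤s⁻¹ k<β)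
... | inj₂ (S , ∣S∣≡β , rooted , avoids) =
  contradiction (avoids⇒disjoint avoids) (maximal S (∣S∣≡β , rooted-connected G rooted))
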